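{- Let $n$ and $r$ be positive integers with $n\ge 3$ and $r$ odd. Then $$\operatorname{mr}^-\left(P_n^{(r)}\right) = \begin{cases} n-r & \text{if } 1 \le r \le n-3 \text{ and } n \text{ is odd},\\ n-r+1 & \text{if } 1 \le r \le n-3 \text{ and } n \text{ is even},\\ 2 & \text{if } r \ge n-2.\end{cases}$$
   Context: All graphs are simple (finite, loopless, undirected). For a graph $G$ on vertex set $\{1,\dots,n\}$, let $\mathcal{S}^-(G)$ be the set of real $n\times n$ skew-symmetric matrices $A=[a_{ij}]$ such that for $i\neq j$, $a_{ij}\neq 0$ if and only if $ij$ is an edge of $G$. The minimum skew rank of $G$ is $\operatorname{mr}^-(G)=\min\{\operatorname{rank}(A): A\in\mathcal{S}^-(G)\}$. $P_n$ denotes the path with vertex set $\{1,\dots,n\}$ where $ij$ is an edge iff $|i-j|=1$. For a positive integer $r$, the strict power $G^{(r)}$ is the simple graph on the same vertex set in which distinct vertices $i,j$ are adjacent iff there is a walk in $G$ from $i$ to $j$ of length exactly $r$ (walks may repeat vertices and edges). -}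

module Defs where

open import Data.Nat using (ℕ; zero; suc; _≤_)
open import Data.Fin using (Fin; toℕ)
import Data.Fin as F
open import Data.Product using (Σ; _×_; _,_)
open import Data.Sum using (_⊎_)
open import Relation.Nullary using (¬_)
open import Relation.Binary.PropositionalEquality using (_≡_; _≢_)
open import Relation.Binary.Definitions using (DecidableEquality)
open import Algebra.Structures using (IsCommutativeRing)

-- The real numbers, axiomatised as a (Dedekind-)complete ordered field.
-- Every model is isomorphic to ℝ, so quantifying over all models is the
-- same as speaking about ℝ.  Decidability of equality is a classical
-- truth about ℝ that we include as an axiom.

record RealField : Set₁ where
  infixl 7 _*_
  infixl 6 _+_
  infix  4 _≤ᵣ_
  field
    R     : Set
    _+_   : R → R → R
    _*_   : R → R → R
    -_    : R → R
    0#    : R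
    1#    : R
    _⁻¹   : R → R
    _≤ᵣ_  : R → R → Set
    isCommutativeRing : IsCommutativeRing _≡_ _+_ _*_ -_ 0# 1#
    0≢1       : 0# ≢ 1#
    ⁻¹-inverse : ∀ x → x ≢ 0# → x * (x ⁻¹) ≡ 1#
    ≤-refl    : ∀ x → x ≤ᵣ x
    ≤-trans   : ∀ {x y z} → x ≤ᵣ y → y ≤ᵣ z → x ≤ᵣ z
    ≤-antisym : ∀ {x y} → x ≤ᵣ y → y ≤ᵣ x → x ≡ y
    ≤-total   : ∀ x y → x ≤ᵣ y ⊎ y ≤ᵣ x
    +-mono-≤  : ∀ {x y} z → x ≤ᵣ y → x + z ≤ᵣ y + z
    *-nonneg  : ∀ {x y} → 0# ≤ᵣ x → 0# ≤ᵣ y → 0# ≤ᵣ x * y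
    complete  : (P : R → Set) → Σ R P → Σ R (λ b → ∀ x → P x → x ≤ᵣ b) →
                Σ R (λ s → (∀ x → P x → x ≤ᵣ s) ×
                           (∀ b → (∀ x → P x → x ≤ᵣ b) → s ≤ᵣ b))
    _≟_       : DecidableEquality R

-- Graphs on vertex set Fin n (vertex i ↔ i+1 of the paper), given by an
-- adjacency relation (assumed symmetric & irreflexive for the graphs used).

Graph : ℕ → Set₁
Graph n = Fin n → Fin n → Set

pathGraph : (n : ℕ) → Graph n
pathGraph n i j = (suc (toℕ i) ≡ toℕ j) ⊎ (suc (toℕ j) ≡ toℕ i)

data Walk {n : ℕ} (G : Graph n) : ℕ → Fin n → Fin n → Set where
  here : ∀ {i} → Walk G zero i i
  step : ∀ {r i k j} → G i k → Walk G r k j → Walk G (suc r) i j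

strictPower : {n : ℕ} → Graph n → ℕ → Graph n
strictPower G r i j = (i ≢ j) × Walk G r i j

module _ (ℝ : RealField) where
  open RealField ℝ

  Matrix : ℕ → Set
  Matrix n = Fin n → Fin n → R

  sumFin : (k : ℕ) → (Fin k → R) → R
  sumFin zero    f = 0#
  sumFin (suc k) f = f F.zero + sumFin k (λ t → f (F.suc t))

  InSkew : {n : ℕ} → Graph n → Matrix n → Set
  InSkew {n} G A =
    (∀ i j → A i j ≡ - (A j i)) ×
    (∀ i j → i ≢ j → ((A i j ≢ 0#) → G i j) × (G i j → A i j ≢ 0#))

  LinIndepCols : {n k : ℕ} → Matrix n → (Fin k → Fin n) → Set
  LinIndepCols {n} {k} A f =
    (c : Fin k → R) → (∀ i → sumFin k (λ t → c t * A i (f t)) ≡ 0#) →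
    ∀ t → c t ≡ 0#

  HasRank : {n : ℕ} → Matrix n → ℕ → Set
  HasRank {n} A m =
    Σ (Fin m → Fin n) (λ f → LinIndepCols A f) ×
    ((g : Fin (suc m) → Fin n) → ¬ LinIndepCols A g)

  IsMinSkewRank : {n : ℕ} → Graph n → ℕ → Set
  IsMinSkewRank {n} G m =
    Σ (Matrix n) (λ A → InSkew G A × HasRank A m) ×
    (∀ A → InSkew G A → ∀ k → HasRank A k → m ≤ k)

-- Write r = 2s + 1 and number the vertices 0, …, n − 1.  In P_n (n ≥ 2) a walk of length r joins
-- i and j exactly when |i − j| ≤ r and i + j is odd, so P_n^(r) is bipartite between even and odd
-- vertices.  Let 2q be the claimed value; then n ≤ 2q + r, and 2q + r ≤ n + 1 unless r ≥ n − 2.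
--
-- Lower bound: in every A ∈ S⁻(P_n^(r)) the columns 2t and 2t + r (t < q) are independent.  Column 2t
-- has a nonzero entry in row 2t + r and column 2t + r one in row 2t; ordering the columns 2t by
-- decreasing t and the columns 2t + r by increasing t, every other entry of these pivot rows in a
-- later column vanishes, by parity or because the two vertices are more than r apart.  For r ≥ n − 2
-- the edge {0, 1} and skew-symmetry already give two independent columns.
--
-- Upper bound: take A = B − Bᵀ with B = Σ_{k<q} u_k v_kᵀ, where u_k and v_k are the 0/1 indicators of
-- the even vertices in [2k, 2k + r + 1] and of the odd vertices in [2k + 1, 2k + r].  Since B is
-- nonnegative, B_ij ≠ 0 iff some k covers both i and j, and for even i and odd j this happens iff
-- |i − j| ≤ r.  So A ∈ S⁻(P_n^(r)), and A factors through 2q columns, so its rank is at most 2q.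

module Submission where

open import Defs
open import Level using (0ℓ)
open import Algebra.Bundles using (CommutativeRing)
open import Data.Nat as Nat using (ℕ; zero; suc; _∸_; _%_; _≤_; _<_; z≤n; s≤s; parity; ⌊_/2⌋)
import Data.Nat.Properties as Natₚ
open import Data.Nat.Tactic.RingSolver using (solve-∀)
open import Data.Parity.Base as ℙ using (0ℙ; 1ℙ)
import Data.Parity.Properties as ℙₚ
open import Data.Fin as Fin using (Fin; toℕ; fromℕ<; _↑ˡ_; _↑ʳ_)
open import Data.Fin.Patterns using (0F; 1F)
import Data.Fin.Properties as Finₚ
open import Data.Vec.Functional using (_++_; replicate)
open import Data.Vec.Functional.Properties using (lookup-++ˡ; lookup-++ʳ)
open import Data.Product using (Σ; ∃; ∃-syntax; _×_; _,_; proj₁; proj₂)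
open import Data.Sum using (_⊎_; inj₁; inj₂)
open import Data.Empty using (⊥-elim)
open import Function using (_∘_; id; _⇔_; mk⇔; Equivalence)
open import Function.Properties.Equivalence using () renaming (trans to ⇔-trans; sym to ⇔-sym)
open import Relation.Nullary using (¬_; Dec; yes; no; ¬?)
open import Relation.Nullary.Decidable using (decidable-stable; _×-dec_)
open import Relation.Binary.PropositionalEquality
open import Relation.Binary.Definitions using (tri<; tri≈; tri>)

module LinearAlgebra (ℝ : RealField) where
  open RealField ℝ

  commutativeRing : CommutativeRing 0ℓ 0ℓ
  commutativeRing = record { isCommutativeRing = isCommutativeRing }

  open CommutativeRing commutativeRing public using (_-_)
  open CommutativeRing commutativeRing
    using (+-assoc; +-comm; *-assoc; *-comm; +-identityˡ; +-identityʳ; *-identityˡ; *-identityʳ;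
           distribʳ; zeroˡ; zeroʳ; -‿inverseʳ; ring; semiring)
  open import Algebra.Properties.Ring ring
    using (-‿distribˡ-*; -‿distribʳ-*; -‿involutive; -‿+-comm; -0#≈0#)
  open import Algebra.Properties.Semiring.Sum semiring public
    using (sum; sum-cong-≗; sum-replicate-zero; ∑-distrib-+; ∑-comm; *-distribˡ-sum; sum-remove)
  open ≡-Reasoning

  x≢0⇒x*y≡0⇒y≡0 : ∀ {x y} → x ≢ 0# → x * y ≡ 0# → y ≡ 0#
  x≢0⇒x*y≡0⇒y≡0 {x} {y} x≢0 x*y≡0 = begin
    y                  ≡⟨ *-identityˡ y ⟨
    1# * y             ≡⟨ cong (_* y) (⁻¹-inverse x x≢0) ⟨
    (x * x ⁻¹) * y     ≡⟨ cong (_* y) (*-comm x (x ⁻¹)) ⟩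
    (x ⁻¹ * x) * y     ≡⟨ *-assoc (x ⁻¹) x y ⟩
    x ⁻¹ * (x * y)     ≡⟨ cong (x ⁻¹ *_) x*y≡0 ⟩
    x ⁻¹ * 0#          ≡⟨ zeroʳ _ ⟩
    0#                 ∎

  *-nonzero : ∀ {x y} → x ≢ 0# → y ≢ 0# → x * y ≢ 0#
  *-nonzero x≢0 y≢0 x*y≡0 = y≢0 (x≢0⇒x*y≡0⇒y≡0 x≢0 x*y≡0)

  1≢0 : 1# ≢ 0#
  1≢0 = 0≢1 ∘ sym

  -‿nonzero : ∀ {x} → x ≢ 0# → - x ≢ 0#
  -‿nonzero {x} x≢0 -x≡0 = x≢0 (trans (sym (-‿involutive x)) (trans (cong -_ -x≡0) -0#≈0#))

  x≤x+y : ∀ x {y} → 0# ≤ᵣ y → x ≤ᵣ x + y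
  x≤x+y x {y} 0≤y = subst₂ _≤ᵣ_ (+-identityˡ x) (+-comm y x) (+-mono-≤ x 0≤y)

  nonneg-+ : ∀ {x y} → 0# ≤ᵣ x → 0# ≤ᵣ y → 0# ≤ᵣ x + y
  nonneg-+ {x} 0≤x 0≤y = ≤-trans 0≤x (x≤x+y x 0≤y)

  nonneg-+≡0⇒≡0 : ∀ {x y} → 0# ≤ᵣ x → 0# ≤ᵣ y → x + y ≡ 0# → x ≡ 0#
  nonneg-+≡0⇒≡0 {x} 0≤x 0≤y x+y≡0 = ≤-antisym (subst (x ≤ᵣ_) x+y≡0 (x≤x+y x 0≤y)) 0≤x

  -- If 1 ≤ 0 then 0 ≤ -1, hence 0 ≤ (-1)(-1) = 1.
  0≤1 : 0# ≤ᵣ 1#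
  0≤1 with ≤-total 0# 1#
  ... | inj₁ 0≤1 = 0≤1
  ... | inj₂ 1≤0 = subst (0# ≤ᵣ_) (-1*-1≡1) (*-nonneg 0≤-1 0≤-1)
    where
    0≤-1 : 0# ≤ᵣ - 1#
    0≤-1 = subst₂ _≤ᵣ_ (-‿inverseʳ 1#) (+-identityˡ (- 1#)) (+-mono-≤ (- 1#) 1≤0)
    -1*-1≡1 : - 1# * - 1# ≡ 1#
    -1*-1≡1 = trans (sym (-‿distribˡ-* 1# (- 1#)))
                    (trans (cong -_ (*-identityˡ (- 1#))) (-‿involutive 1#))

  x≡-x⇒x≡0 : ∀ {x} → x ≡ - x → x ≡ 0#
  x≡-x⇒x≡0 {x} x≡-x = x≢0⇒x*y≡0⇒y≡0 2≢0 (begin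
    (1# + 1#) * x     ≡⟨ distribʳ x 1# 1# ⟩
    1# * x + 1# * x   ≡⟨ cong₂ _+_ (*-identityˡ x) (*-identityˡ x) ⟩
    x + x             ≡⟨ cong (x +_) x≡-x ⟩
    x + - x           ≡⟨ -‿inverseʳ x ⟩
    0#                ∎)
    where
    2≢0 : 1# + 1# ≢ 0#
    2≢0 = 1≢0 ∘ nonneg-+≡0⇒≡0 0≤1 0≤1

  sumFin≡sum : ∀ k (f : Fin k → R) → sumFin ℝ k f ≡ sum f
  sumFin≡sum zero    f = refl
  sumFin≡sum (suc k) f = cong (f 0F +_) (sumFin≡sum k (f ∘ Fin.suc))

  sum-zero : ∀ {k} {f : Fin k → R} → (∀ t → f t ≡ 0#) → sum f ≡ 0#
  sum-zero {k} f≡0 = trans (sum-cong-≗ f≡0) (sum-replicate-zero k)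

  sum-neg : ∀ {k} (f : Fin k → R) → sum (λ t → - f t) ≡ - sum f
  sum-neg {zero}  f = sym -0#≈0#
  sum-neg {suc k} f = trans (cong (- f 0F +_) (sum-neg (f ∘ Fin.suc))) (-‿+-comm _ _)

  sum-↑ : ∀ m {n} (f : Fin (m Nat.+ n) → R) → sum f ≡ sum (f ∘ (_↑ˡ n)) + sum (f ∘ (m ↑ʳ_))
  sum-↑ zero    f = sym (+-identityˡ _)
  sum-↑ (suc m) f = trans (cong (f 0F +_) (sum-↑ m (f ∘ Fin.suc))) (sym (+-assoc _ _ _))

  sum-single : ∀ {k} {f : Fin k → R} t₀ → (∀ t → t ≢ t₀ → f t ≡ 0#) → sum f ≡ f t₀
  sum-single {suc k} {f} t₀ f≡0 = begin
    sum f                            ≡⟨ sum-remove {i = t₀} f ⟩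
    f t₀ + sum (f ∘ Fin.punchIn t₀)  ≡⟨ cong (f t₀ +_) (sum-zero (λ t → f≡0 _ (Finₚ.punchInᵢ≢i t₀ t))) ⟩
    f t₀ + 0#                        ≡⟨ +-identityʳ _ ⟩
    f t₀                             ∎

  sum-nonneg : ∀ {k} (f : Fin k → R) → (∀ t → 0# ≤ᵣ f t) → 0# ≤ᵣ sum f
  sum-nonneg {zero}  f 0≤f = ≤-refl 0#
  sum-nonneg {suc k} f 0≤f = nonneg-+ (0≤f 0F) (sum-nonneg (f ∘ Fin.suc) (0≤f ∘ Fin.suc))

  nonneg-sum≢0 : ∀ {k} (f : Fin k → R) → (∀ t → 0# ≤ᵣ f t) → ∀ t₀ → f t₀ ≢ 0# → sum f ≢ 0#
  nonneg-sum≢0 {suc k} f 0≤f 0F f₀≢0 =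
    f₀≢0 ∘ nonneg-+≡0⇒≡0 (0≤f 0F) (sum-nonneg (f ∘ Fin.suc) (0≤f ∘ Fin.suc))
  nonneg-sum≢0 {suc k} f 0≤f (Fin.suc t₀) fₜ≢0 =
    nonneg-sum≢0 (f ∘ Fin.suc) (0≤f ∘ Fin.suc) t₀ fₜ≢0 ∘
    nonneg-+≡0⇒≡0 (sum-nonneg (f ∘ Fin.suc) (0≤f ∘ Fin.suc)) (0≤f 0F) ∘ trans (+-comm _ _)

  sum≢0⇒∃≢0 : ∀ {k} (f : Fin k → R) → sum f ≢ 0# → ∃[ t ] f t ≢ 0#
  sum≢0⇒∃≢0 f sum≢0 with Finₚ.any? (λ t → ¬? (f t ≟ 0#))
  ... | yes found = found
  ... | no none   = ⊥-elim (sum≢0 (sum-zero (λ t → decidable-stable (f t ≟ 0#) (none ∘ (t ,_)))))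

  indicator : ∀ {A : Set} → Dec A → R
  indicator (yes _) = 1#
  indicator (no _)  = 0#

  indicator-nonneg : ∀ {A : Set} (d : Dec A) → 0# ≤ᵣ indicator d
  indicator-nonneg (yes _) = 0≤1
  indicator-nonneg (no _)  = ≤-refl 0#

  indicator≢0⇒holds : ∀ {A : Set} (d : Dec A) → indicator d ≢ 0# → A
  indicator≢0⇒holds (yes a) _   = a
  indicator≢0⇒holds (no _)  0≢0 = ⊥-elim (0≢0 refl)

  indicator-holds : ∀ {A : Set} (d : Dec A) → A → indicator d ≡ 1#
  indicator-holds (yes _) _ = refl
  indicator-holds (no ¬a) a = ⊥-elim (¬a a)

  x-0≡x : ∀ x → x - 0# ≡ x
  x-0≡x x = trans (cong (x +_) -0#≈0#) (+-identityʳ x)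

  0-x≡-x : ∀ x → 0# - x ≡ - x
  0-x≡-x x = +-identityˡ (- x)

  x-y≡-[y-x] : ∀ x y → x - y ≡ - (y - x)
  x-y≡-[y-x] x y = begin
    x + - y        ≡⟨ +-comm x (- y) ⟩
    - y + x        ≡⟨ cong (- y +_) (-‿involutive x) ⟨
    - y + - - x    ≡⟨ -‿+-comm y (- x) ⟩
    - (y + - x)    ∎

  Nontrivial : ∀ {k} → (Fin k → R) → Set
  Nontrivial c = ∃[ t ] c t ≢ 0#

  Solves : ∀ {N k} → (Fin N → Fin k → R) → (Fin k → R) → Set
  Solves Y c = ∀ l → sum (λ t → Y l t * c t) ≡ 0#

  pivotReduce : ∀ {N k} → (Fin N → Fin (suc k) → R) → Fin N → Fin N → Fin k → R
  pivotReduce Y l₀ l t = Y l₀ 0F * Y l (Fin.suc t) - Y l 0F * Y l₀ (Fin.suc t)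

  pivot-identity : ∀ {k} (a b : R) (y z c : Fin k → R) →
    b * - sum (λ t → z t * c t) + sum (λ t → y t * (a * c t)) ≡ sum (λ t → (a * y t - b * z t) * c t)
  pivot-identity a b y z c = begin
    b * - sum zc + sum yac                 ≡⟨ +-comm _ _ ⟩
    sum yac + b * - sum zc                 ≡⟨ cong (sum yac +_) (-‿distribʳ-* b (sum zc)) ⟨
    sum yac + - (b * sum zc)               ≡⟨ cong (λ x → sum yac + - x) (*-distribˡ-sum b zc) ⟩
    sum yac + - sum (λ t → b * zc t)       ≡⟨ cong (sum yac +_) (sum-neg (λ t → b * zc t)) ⟨
    sum yac + sum (λ t → - (b * zc t))     ≡⟨ ∑-distrib-+ yac (λ t → - (b * zc t)) ⟨
    sum (λ t → yac t + - (b * zc t))       ≡⟨ sum-cong-≗ term ⟨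
    sum (λ t → (a * y t - b * z t) * c t)  ∎
    where
    zc yac : Fin _ → R
    zc t = z t * c t
    yac t = y t * (a * c t)
    term : ∀ t → (a * y t - b * z t) * c t ≡ yac t + - (b * zc t)
    term t = begin
      (a * y t + - (b * z t)) * c t       ≡⟨ distribʳ (c t) (a * y t) (- (b * z t)) ⟩
      (a * y t) * c t + - (b * z t) * c t ≡⟨ cong₂ _+_
          (trans (cong (_* c t) (*-comm a (y t))) (*-assoc (y t) a (c t)))
          (trans (sym (-‿distribˡ-* (b * z t) (c t))) (cong -_ (*-assoc b (z t) (c t)))) ⟩
      yac t + - (b * zc t)                ∎

  -- Gaussian elimination: a row l₀ with a nonzero first coefficient eliminates the first unknown,
  -- the other rows are solved by induction, and the first unknown is recovered from row l₀.
  nontrivial-solution : ∀ N (Y : Fin N → Fin (suc N) → R) → ∃[ c ] Nontrivial c × Solves Y c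
  nontrivial-solution zero    Y = (λ _ → 1#) , (0F , 1≢0) , λ ()
  nontrivial-solution (suc N) Y with Finₚ.any? (λ l → ¬? (Y l 0F ≟ 0#))
  ... | no no-pivot = e₀ , (0F , 1≢0) , solves
    where
    e₀ : Fin (suc (suc N)) → R
    e₀ 0F          = 1#
    e₀ (Fin.suc _) = 0#
    solves : Solves Y e₀
    solves l = begin
      Y l 0F * 1# + sum (λ t → Y l (Fin.suc t) * 0#)
        ≡⟨ cong₂ _+_ (*-identityʳ _) (sum-zero (zeroʳ ∘ Y l ∘ Fin.suc)) ⟩
      Y l 0F + 0#
        ≡⟨ +-identityʳ _ ⟩
      Y l 0F
        ≡⟨ decidable-stable (Y l 0F ≟ 0#) (no-pivot ∘ (l ,_)) ⟩
      0# ∎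
  ... | yes (l₀ , a≢0) with nontrivial-solution N (pivotReduce Y l₀ ∘ Fin.punchIn l₀)
  ... | c′ , (t₀ , c′t₀≢0) , c′-solves = c , (Fin.suc t₀ , *-nonzero a≢0 c′t₀≢0) , solves
    where
    a = Y l₀ 0F
    c : Fin (suc (suc N)) → R
    c 0F          = - sum (λ t → Y l₀ (Fin.suc t) * c′ t)
    c (Fin.suc t) = a * c′ t
    reduced : Solves (pivotReduce Y l₀) c′
    reduced l with l₀ Fin.≟ l
    ... | yes refl = sum-zero {f = λ t → pivotReduce Y l₀ l₀ t * c′ t}
                       (λ t → trans (cong (_* c′ t) (-‿inverseʳ (a * Y l₀ (Fin.suc t)))) (zeroˡ (c′ t)))
    ... | no l₀≢l = subst (λ l′ → sum (λ t → pivotReduce Y l₀ l′ t * c′ t) ≡ 0#)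
                          (Finₚ.punchIn-punchOut l₀≢l) (c′-solves (Fin.punchOut l₀≢l))
    solves : Solves Y c
    solves l = trans (pivot-identity a (Y l 0F) (Y l ∘ Fin.suc) (Y l₀ ∘ Fin.suc) c′) (reduced l)

  factorization⇒dependent : ∀ {n} M (A : Matrix ℝ n) (X : Fin n → Fin M → R) (Y : Fin M → Fin n → R) →
    (∀ i j → A i j ≡ sum (λ l → X i l * Y l j)) → (g : Fin (suc M) → Fin n) → ¬ LinIndepCols ℝ A g
  factorization⇒dependent M A X Y A≡XY g independent with nontrivial-solution M (λ l t → Y l (g t))
  ... | c , (t₀ , cₜ₀≢0) , solves = cₜ₀≢0 (independent c combination t₀)
    where
    combination : ∀ i → sumFin ℝ (suc M) (λ t → c t * A i (g t)) ≡ 0#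
    combination i = begin
      sumFin ℝ (suc M) (λ t → c t * A i (g t))
        ≡⟨ sumFin≡sum (suc M) (λ t → c t * A i (g t)) ⟩
      sum (λ t → c t * A i (g t))
        ≡⟨ sum-cong-≗ expand ⟩
      sum (λ t → sum (λ l → c t * (X i l * Y l (g t))))
        ≡⟨ ∑-comm (λ t l → c t * (X i l * Y l (g t))) ⟩
      sum (λ l → sum (λ t → c t * (X i l * Y l (g t))))
        ≡⟨ sum-cong-≗ collect ⟩
      sum (λ l → X i l * sum (λ t → Y l (g t) * c t))
        ≡⟨ sum-zero (λ l → trans (cong (X i l *_) (solves l)) (zeroʳ (X i l))) ⟩
      0# ∎
      where
      expand : ∀ t → c t * A i (g t) ≡ sum (λ l → c t * (X i l * Y l (g t)))
      expand t = trans (cong (c t *_) (A≡XY i (g t))) (*-distribˡ-sum (c t) (λ l → X i l * Y l (g t)))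
      collect : ∀ l → sum (λ t → c t * (X i l * Y l (g t))) ≡ X i l * sum (λ t → Y l (g t) * c t)
      collect l = trans (sum-cong-≗ (λ t → trans (*-comm (c t) _) (*-assoc (X i l) (Y l (g t)) (c t))))
                        (sym (*-distribˡ-sum (X i l) (λ t → Y l (g t) * c t)))

  triangular⇒independent : ∀ {n m} (A : Matrix ℝ n) (f g : Fin m → Fin n) (rank : Fin m → ℕ) →
    (∀ t → A (g t) (f t) ≢ 0#) →
    (∀ t t′ → t′ ≢ t → A (g t) (f t′) ≡ 0# ⊎ rank t′ < rank t) →
    LinIndepCols ℝ A f
  triangular⇒independent {m = m} A f g rank pivot≢0 triangular c combination t =
    vanish (suc (rank t)) t Natₚ.≤-refl
    where
    vanish : ∀ k t → rank t < k → c t ≡ 0#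
    vanish (suc k) t (s≤s rankₜ≤k) = x≢0⇒x*y≡0⇒y≡0 (pivot≢0 t) (trans (*-comm _ _) pivot-term≡0)
      where
      other-terms : ∀ t′ → t′ ≢ t → c t′ * A (g t) (f t′) ≡ 0#
      other-terms t′ t′≢t with triangular t t′ t′≢t
      ... | inj₁ entry≡0 = trans (cong (c t′ *_) entry≡0) (zeroʳ _)
      ... | inj₂ lower   =
        trans (cong (_* A (g t) (f t′)) (vanish k t′ (Natₚ.<-≤-trans lower rankₜ≤k))) (zeroˡ _)
      pivot-term≡0 : c t * A (g t) (f t) ≡ 0#
      pivot-term≡0 = trans (sym (sum-single t other-terms)) (trans (sym (sumFin≡sum m _)) (combination (g t)))

  IndependentColumns : ∀ {n} → Matrix ℝ n → ℕ → Set
  IndependentColumns {n} A m = Σ (Fin m → Fin n) (LinIndepCols ℝ A)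

  independent-↑ˡ : ∀ {n a} b (A : Matrix ℝ n) (f : Fin (a Nat.+ b) → Fin n) →
                   LinIndepCols ℝ A f → LinIndepCols ℝ A (f ∘ (_↑ˡ b))
  independent-↑ˡ {a = a} b A f independent c combination t =
    trans (sym (lookup-++ˡ c 0s t)) (independent (c ++ 0s) extended (t ↑ˡ b))
    where
    0s : Fin b → R
    0s = replicate b 0#
    extended : ∀ i → sumFin ℝ (a Nat.+ b) (λ u → (c ++ 0s) u * A i (f u)) ≡ 0#
    extended i = begin
      sumFin ℝ (a Nat.+ b) (λ u → (c ++ 0s) u * A i (f u))      ≡⟨ sumFin≡sum (a Nat.+ b) _ ⟩
      sum (λ u → (c ++ 0s) u * A i (f u))                        ≡⟨ sum-↑ a _ ⟩
      sum (λ u → (c ++ 0s) (u ↑ˡ b) * A i (f (u ↑ˡ b))) +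
      sum (λ u → (c ++ 0s) (a ↑ʳ u) * A i (f (a ↑ʳ u)))          ≡⟨ cong₂ _+_
          (sum-cong-≗ (λ u → cong (_* A i (f (u ↑ˡ b))) (lookup-++ˡ c 0s u)))
          (sum-zero (λ u → trans (cong (_* A i (f (a ↑ʳ u))) (lookup-++ʳ c 0s u)) (zeroˡ _))) ⟩
      sum (λ u → c u * A i (f (u ↑ˡ b))) + 0#                    ≡⟨ +-identityʳ _ ⟩
      sum (λ u → c u * A i (f (u ↑ˡ b)))                         ≡⟨ sumFin≡sum a _ ⟨
      sumFin ℝ a (λ u → c u * A i (f (u ↑ˡ b)))                  ≡⟨ combination i ⟩
      0#                                                         ∎

  independent⇒rank≥ : ∀ {n m k} {A : Matrix ℝ n} → IndependentColumns A m → HasRank ℝ A k → m ≤ k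
  independent⇒rank≥ {m = m} {k} {A} (f , independent) (_ , no-larger) with m Natₚ.≤? k
  ... | yes m≤k = m≤k
  ... | no m≰k with d , refl ← Natₚ.m≤n⇒∃[o]m+o≡n (Natₚ.≰⇒> m≰k) =
    ⊥-elim (no-larger (f ∘ (_↑ˡ d)) (independent-↑ˡ {a = suc k} d A f independent))

  factorization⇒isMinSkewRank : ∀ {n} (G : Graph n) m →
    (∀ A → InSkew ℝ G A → IndependentColumns A m) →
    (A₀ : Matrix ℝ n) → InSkew ℝ G A₀ → (X : Fin n → Fin m → R) (Y : Fin m → Fin n → R) →
    (∀ i j → A₀ i j ≡ sum (λ l → X i l * Y l j)) → IsMinSkewRank ℝ G m
  factorization⇒isMinSkewRank G m lower A₀ A₀∈S X Y A₀≡XY =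
    (A₀ , A₀∈S , lower A₀ A₀∈S , factorization⇒dependent m A₀ X Y A₀≡XY) ,
    λ A A∈S k rank → independent⇒rank≥ {A = A} (lower A A∈S) rank

  module _ {n} {G : Graph n} {A : Matrix ℝ n} (A∈S : InSkew ℝ G A) where

    diagonal≡0 : ∀ i → A i i ≡ 0#
    diagonal≡0 i = x≡-x⇒x≡0 (proj₁ A∈S i i)

    nonadjacent⇒entry≡0 : ∀ {i j} → ¬ G i j → A i j ≡ 0#
    nonadjacent⇒entry≡0 {i} {j} ¬Gij with i Fin.≟ j
    ... | yes refl = diagonal≡0 i
    ... | no i≢j   = decidable-stable (A i j ≟ 0#) (¬Gij ∘ proj₁ (proj₂ A∈S i j i≢j))

    adjacent⇒entry≢0 : ∀ {i j} → i ≢ j → G i j → A i j ≢ 0#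
    adjacent⇒entry≢0 {i} {j} i≢j = proj₂ (proj₂ A∈S i j i≢j)

    entry≢0⇒independent-pair : ∀ {i j} → A i j ≢ 0# → IndependentColumns A 2
    entry≢0⇒independent-pair {i} {j} Aij≢0 = f , triangular⇒independent A f g (λ _ → 0) pivot≢0 off-pivot
      where
      f g : Fin 2 → Fin n
      f 0F = i
      f (Fin.suc _) = j
      g 0F = j
      g (Fin.suc _) = i
      pivot≢0 : ∀ t → A (g t) (f t) ≢ 0#
      pivot≢0 0F = -‿nonzero Aij≢0 ∘ trans (sym (proj₁ A∈S j i))
      pivot≢0 1F = Aij≢0
      off-pivot : ∀ t t′ → t′ ≢ t → A (g t) (f t′) ≡ 0# ⊎ 0 < 0
      off-pivot 0F 0F t′≢t = ⊥-elim (t′≢t refl)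
      off-pivot 0F 1F _ = inj₁ (diagonal≡0 j)
      off-pivot 1F 0F _ = inj₁ (diagonal≡0 i)
      off-pivot 1F 1F t′≢t = ⊥-elim (t′≢t refl)

open Nat using (_+_)

-- Parity and halving

parity-double : ∀ a → parity (a + a) ≡ 0ℙ
parity-double a = trans (ℙₚ.+-homo-+ a a) (ℙₚ.p+p≡0ℙ (parity a))

parity-suc-double : ∀ a → parity (suc (a + a)) ≡ 1ℙ
parity-suc-double a = trans (ℙₚ.+-homo-+ 1 (a + a)) (cong (1ℙ ℙ.+_) (parity-double a))

even⇒double : ∀ x → parity x ≡ 0ℙ → ∃[ a ] x ≡ a + a
even⇒double zero          _ = 0 , refl
even⇒double (suc (suc x)) p with even⇒double x p
... | a , refl = suc a , cong suc (sym (Natₚ.+-suc a a))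

odd⇒suc-double : ∀ x → parity x ≡ 1ℙ → ∃[ a ] x ≡ suc (a + a)
odd⇒suc-double (suc zero)    _ = 0 , refl
odd⇒suc-double (suc (suc x)) p with odd⇒suc-double x p
... | a , refl = suc a , cong (suc ∘ suc) (sym (Natₚ.+-suc a a))

%2≡0⇒even : ∀ x → x % 2 ≡ 0 → parity x ≡ 0ℙ
%2≡0⇒even zero          _ = refl
%2≡0⇒even (suc (suc x)) p = %2≡0⇒even x p

%2≡1⇒odd : ∀ x → x % 2 ≡ 1 → parity x ≡ 1ℙ
%2≡1⇒odd (suc zero)    _ = refl
%2≡1⇒odd (suc (suc x)) p = %2≡1⇒odd x p

⌊double/2⌋ : ∀ a → ⌊ a + a /2⌋ ≡ a
⌊double/2⌋ a = sym (Natₚ.n≡⌊n+n/2⌋ a)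

⌊suc-double/2⌋ : ∀ a → ⌊ suc (a + a) /2⌋ ≡ a
⌊suc-double/2⌋ zero    = refl
⌊suc-double/2⌋ (suc a) rewrite Natₚ.+-suc a a = cong suc (⌊suc-double/2⌋ a)

x+x≤1+y+y⇒x≤y : ∀ x y → x + x ≤ suc (y + y) → x ≤ y
x+x≤1+y+y⇒x≤y zero    y       _ = z≤n
x+x≤1+y+y⇒x≤y (suc x) zero    h rewrite Natₚ.+-suc x x with s≤s () ← h
x+x≤1+y+y⇒x≤y (suc x) (suc y) h rewrite Natₚ.+-suc x x | Natₚ.+-suc y y =
  s≤s (x+x≤1+y+y⇒x≤y x y (Natₚ.≤-pred (Natₚ.≤-pred h)))

even-or-odd : ∀ x → (∃[ a ] x ≡ a + a) ⊎ (∃[ a ] x ≡ suc (a + a))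
even-or-odd x with parity x in eq
... | 0ℙ = inj₁ (even⇒double x eq)
... | 1ℙ = inj₂ (odd⇒suc-double x eq)

double⇒even : ∀ {x a} → x ≡ a + a → parity x ≡ 0ℙ
double⇒even {a = a} refl = parity-double a

suc-double⇒odd : ∀ {x a} → x ≡ suc (a + a) → parity x ≡ 1ℙ
suc-double⇒odd {a = a} refl = parity-suc-double a

parity-suc : ∀ x → parity (suc x) ≡ parity x ℙ.⁻¹
parity-suc x = ℙₚ.+-homo-+ 1 x

parity-+-same : ∀ {x y} → parity x ≡ parity y → parity (x + y) ≡ 0ℙ
parity-+-same {x} {y} eq =
  trans (ℙₚ.+-homo-+ x y) (trans (cong (ℙ._+ parity y) eq) (ℙₚ.p+p≡0ℙ (parity y)))

parity-∸ : ∀ {n r} → r ≤ n → parity (n ∸ r) ℙ.+ parity r ≡ parity n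
parity-∸ {n} {r} r≤n = trans (sym (ℙₚ.+-homo-+ (n ∸ r) r)) (cong parity (Natₚ.m∸n+n≡m r≤n))

odd∸odd≡even : ∀ {n r} → r ≤ n → parity n ≡ 1ℙ → parity r ≡ 1ℙ → parity (n ∸ r) ≡ 0ℙ
odd∸odd≡even {n} {r} r≤n n-odd r-odd =
  ℙₚ.+-cancelʳ-≡ 1ℙ (parity (n ∸ r)) 0ℙ
    (trans (cong (parity (n ∸ r) ℙ.+_) (sym r-odd)) (trans (parity-∸ r≤n) n-odd))

even∸odd+1≡even : ∀ {n r} → r ≤ n → parity n ≡ 0ℙ → parity r ≡ 1ℙ → parity (n ∸ r + 1) ≡ 0ℙ
even∸odd+1≡even {n} {r} r≤n n-even r-odd =
  trans (ℙₚ.+-homo-+ (n ∸ r) 1)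
    (trans (cong (parity (n ∸ r) ℙ.+_) (sym r-odd)) (trans (parity-∸ r≤n) n-even))

m∸n+1+n≡1+m : ∀ {m n} → n ≤ m → m ∸ n + 1 + n ≡ suc m
m∸n+1+n≡1+m {m} {n} n≤m =
  trans (Natₚ.+-assoc (m ∸ n) 1 n) (trans (Natₚ.+-suc (m ∸ n) n) (cong suc (Natₚ.m∸n+n≡m n≤m)))

m≤o∸n⇒m<o : ∀ {m n o} → 0 < n → n ≤ o → m ≤ o ∸ n → m < o
m≤o∸n⇒m<o {m} 0<n n≤o m≤o∸n =
  Natₚ.<-≤-trans (Natₚ.m<m+n m 0<n) (Natₚ.m≤o∸n⇒m+n≤o m n≤o m≤o∸n)

x+x+[1+s+s]≡1+[x+s]+[x+s] : ∀ x s → x + x + suc (s + s) ≡ suc ((x + s) + (x + s))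
x+x+[1+s+s]≡1+[x+s]+[x+s] = solve-∀

[1+x+x]+[1+s+s]≡[1+x+s]+[1+x+s] : ∀ x s → suc (x + x) + suc (s + s) ≡ suc (x + s) + suc (x + s)
[1+x+x]+[1+s+s]≡[1+x+s]+[1+x+s] = solve-∀

-- Walks in the path P_n

module _ {n : ℕ} where

  private
    P : Graph n
    P = pathGraph n

  path-sym : ∀ {i j} → P i j → P j i
  path-sym (inj₁ e) = inj₂ e
  path-sym (inj₂ e) = inj₁ e

  castWalk : ∀ {a b i j} → a ≡ b → Walk P a i j → Walk P b i j
  castWalk refl w = w

  _▷_ : ∀ {a i k j} → Walk P a i k → P k j → Walk P (suc a) i j
  here     ▷ e′ = step e′ here
  step e w ▷ e′ = step e (w ▷ e′)

  reverseWalk : ∀ {a i j} → Walk P a i j → Walk P a j i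
  reverseWalk here       = here
  reverseWalk (step e w) = reverseWalk w ▷ path-sym e

  _++ʷ_ : ∀ {a b i k j} → Walk P a i k → Walk P b k j → Walk P (a + b) i j
  here     ++ʷ w′ = w′
  step e w ++ʷ w′ = step e (w ++ʷ w′)

  ascendingWalk : ∀ d {i j} → toℕ i + d ≡ toℕ j → Walk P d i j
  ascendingWalk zero    {i} {j} e =
    subst (Walk P 0 i) (Finₚ.toℕ-injective (trans (sym (Natₚ.+-identityʳ (toℕ i))) e)) here
  ascendingWalk (suc d) {i} {j} e =
    step (inj₁ (sym (Finₚ.toℕ-fromℕ< i+1<n)))
         (ascendingWalk d (trans (cong (_+ d) (Finₚ.toℕ-fromℕ< i+1<n))
                                 (trans (sym (Natₚ.+-suc (toℕ i) d)) e)))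
    where
    i+1<n : suc (toℕ i) < n
    i+1<n = Natₚ.≤-<-trans (Natₚ.≤-trans (s≤s (Natₚ.m≤m+n (toℕ i) d))
                                          (Natₚ.≤-reflexive (trans (sym (Natₚ.+-suc (toℕ i) d)) e)))
                            (Finₚ.toℕ<n j)

  neighbour : 2 ≤ n → ∀ j → ∃ (P j)
  neighbour 2≤n j with toℕ j in eq
  ... | zero  = fromℕ< 2≤n , inj₁ (sym (Finₚ.toℕ-fromℕ< 2≤n))
  ... | suc y = fromℕ< y<n , inj₂ (cong suc (Finₚ.toℕ-fromℕ< y<n))
    where
    y<n : y < n
    y<n = Natₚ.<-trans (Natₚ.n<1+n y) (subst (_< n) eq (Finₚ.toℕ<n j))

  backAndForth : 2 ≤ n → ∀ e j → Walk P (e + e) j j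
  backAndForth 2≤n zero    j = here
  backAndForth 2≤n (suc e) j = castWalk (cong suc (sym (Natₚ.+-suc e e)))
    (step edge (step (path-sym edge) (backAndForth 2≤n e j)))
    where edge = proj₂ (neighbour 2≤n j)

  walk⇒parity : ∀ {a i j} → Walk P a i j → parity (toℕ i + toℕ j) ≡ parity a
  walk⇒parity {i = i} here = parity-double (toℕ i)
  walk⇒parity {suc a} {i} {j} (step {k = k} (inj₁ e) w) = begin
    parity (toℕ i + toℕ j)            ≡⟨ ℙₚ.⁻¹-involutive _ ⟨
    parity (toℕ i + toℕ j) ℙ.⁻¹ ℙ.⁻¹  ≡⟨ cong ℙ._⁻¹ (parity-suc (toℕ i + toℕ j)) ⟨
    parity (suc (toℕ i) + toℕ j) ℙ.⁻¹ ≡⟨ cong (λ x → parity (x + toℕ j) ℙ.⁻¹) e ⟩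
    parity (toℕ k + toℕ j) ℙ.⁻¹       ≡⟨ cong ℙ._⁻¹ (walk⇒parity w) ⟩
    parity a ℙ.⁻¹                     ≡⟨ parity-suc a ⟨
    parity (suc a)                    ∎
    where open ≡-Reasoning
  walk⇒parity {suc a} {i} {j} (step {k = k} (inj₂ e) w) = begin
    parity (toℕ i + toℕ j)        ≡⟨ cong (λ x → parity (x + toℕ j)) e ⟨
    parity (suc (toℕ k) + toℕ j)  ≡⟨ parity-suc (toℕ k + toℕ j) ⟩
    parity (toℕ k + toℕ j) ℙ.⁻¹   ≡⟨ cong ℙ._⁻¹ (walk⇒parity w) ⟩
    parity a ℙ.⁻¹                 ≡⟨ parity-suc a ⟨
    parity (suc a)                ∎
    where open ≡-Reasoning

  walk⇒≤ : ∀ {a i j} → Walk P a i j → toℕ j ≤ toℕ i + a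
  walk⇒≤ {i = i} here = Natₚ.m≤m+n (toℕ i) 0
  walk⇒≤ {suc a} {i} {j} (step {k = k} (inj₁ e) w) = begin
    toℕ j            ≤⟨ walk⇒≤ w ⟩
    toℕ k + a        ≡⟨ cong (_+ a) e ⟨
    suc (toℕ i) + a  ≡⟨ Natₚ.+-suc (toℕ i) a ⟨
    toℕ i + suc a    ∎
    where open Natₚ.≤-Reasoning
  walk⇒≤ {suc a} {i} {j} (step {k = k} (inj₂ e) w) = begin
    toℕ j            ≤⟨ walk⇒≤ w ⟩
    toℕ k + a        ≤⟨ Natₚ.n≤1+n _ ⟩
    suc (toℕ k) + a  ≡⟨ cong (_+ a) e ⟩
    toℕ i + a        ≤⟨ Natₚ.+-monoʳ-≤ (toℕ i) (Natₚ.n≤1+n a) ⟩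
    toℕ i + suc a    ∎
    where open Natₚ.≤-Reasoning

  same-parity⇒¬odd-walk : ∀ {a i j} → parity a ≡ 1ℙ → parity (toℕ i) ≡ parity (toℕ j) → ¬ Walk P a i j
  same-parity⇒¬odd-walk {i = i} {j} a-odd same w
    with () ← trans (sym (parity-+-same {toℕ i} {toℕ j} same)) (trans (walk⇒parity w) a-odd)

  odd-walk⇒distinct : ∀ {a i j} → parity a ≡ 1ℙ → Walk P a i j → i ≢ j
  odd-walk⇒distinct a-odd w refl = same-parity⇒¬odd-walk a-odd refl w

  private
    ascending-walk-exists : 2 ≤ n → ∀ {a d i j} → toℕ i + d ≡ toℕ j → d ≤ a →
                            parity (toℕ i + toℕ j) ≡ parity a → Walk P a i j
    ascending-walk-exists 2≤n {a} {d} {i} {j} i+d≡j d≤a parity≡ = walk (Natₚ.m≤n⇒∃[o]m+o≡n d≤a)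
      where
      excess-even : ∀ m → d + m ≡ a → parity m ≡ 0ℙ
      excess-even m d+m≡a = ℙₚ.+-cancelˡ-≡ (parity d) (parity m) 0ℙ (begin
        parity d ℙ.+ parity m                ≡⟨ ℙₚ.+-homo-+ d m ⟨
        parity (d + m)                       ≡⟨ cong parity d+m≡a ⟩
        parity a                             ≡⟨ parity≡ ⟨
        parity (toℕ i + toℕ j)               ≡⟨ cong (λ x → parity (toℕ i + x)) i+d≡j ⟨
        parity (toℕ i + (toℕ i + d))         ≡⟨ cong parity (Natₚ.+-assoc (toℕ i) (toℕ i) d) ⟨
        parity (toℕ i + toℕ i + d)           ≡⟨ ℙₚ.+-homo-+ (toℕ i + toℕ i) d ⟩
        parity (toℕ i + toℕ i) ℙ.+ parity d  ≡⟨ cong (ℙ._+ parity d) (parity-double (toℕ i)) ⟩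
        parity d                             ≡⟨ ℙₚ.+-identityʳ (parity d) ⟨
        parity d ℙ.+ 0ℙ                      ∎)
        where open ≡-Reasoning

      walk : ∃[ m ] d + m ≡ a → Walk P a i j
      walk (m , d+m≡a) with e , refl ← even⇒double m (excess-even m d+m≡a) =
        castWalk d+m≡a (ascendingWalk d i+d≡j ++ʷ backAndForth 2≤n e j)

  walk-exists : 2 ≤ n → ∀ {a i j} → toℕ j ≤ toℕ i + a → toℕ i ≤ toℕ j + a →
                parity (toℕ i + toℕ j) ≡ parity a → Walk P a i j
  walk-exists 2≤n {a} {i} {j} j≤i+a i≤j+a parity≡ with Natₚ.≤-total (toℕ i) (toℕ j)
  ... | inj₁ i≤j with d , i+d≡j ← Natₚ.m≤n⇒∃[o]m+o≡n i≤j =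
    ascending-walk-exists 2≤n i+d≡j
      (Natₚ.+-cancelˡ-≤ (toℕ i) d a (subst (_≤ toℕ i + a) (sym i+d≡j) j≤i+a)) parity≡
  ... | inj₂ j≤i with d , j+d≡i ← Natₚ.m≤n⇒∃[o]m+o≡n j≤i =
    reverseWalk (ascending-walk-exists 2≤n j+d≡i
      (Natₚ.+-cancelˡ-≤ (toℕ j) d a (subst (_≤ toℕ j + a) (sym j+d≡i) i≤j+a))
      (trans (cong parity (Natₚ.+-comm (toℕ j) (toℕ i))) parity≡))

-- For the even vertex 2a and the odd vertex 2b + 1, EvenWindow k a and OddWindow k b say that they
-- lie in the supports of u_k and v_k, and Band a b says that |2a − (2b + 1)| ≤ 2s + 1.
module Windows (s : ℕ) where

  EvenWindow OddWindow Band : ℕ → ℕ → Set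
  EvenWindow k a = k ≤ a × a ≤ suc (k + s)
  OddWindow  k b = k ≤ b × b ≤ k + s
  Band a b = a ≤ suc (b + s) × b ≤ a + s

  evenWindow? : ∀ k a → Dec (EvenWindow k a)
  evenWindow? k a = k Natₚ.≤? a ×-dec a Natₚ.≤? suc (k + s)

  oddWindow? : ∀ k b → Dec (OddWindow k b)
  oddWindow? k b = k Natₚ.≤? b ×-dec b Natₚ.≤? k + s

  windows⇒band : ∀ {k a b} → EvenWindow k a → OddWindow k b → Band a b
  windows⇒band (k≤a , a≤1+k+s) (k≤b , b≤k+s) =
    Natₚ.≤-trans a≤1+k+s (s≤s (Natₚ.+-monoˡ-≤ s k≤b)) ,
    Natₚ.≤-trans b≤k+s (Natₚ.+-monoˡ-≤ s k≤a)

  -- The window index is min (a, b, q − 1).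
  band⇒windows : ∀ q {a b} → 1 ≤ q → Band a b → a ≤ q + s → suc b ≤ q + s →
                 ∃[ k ] k < q × EvenWindow k a × OddWindow k b
  band⇒windows (suc q′) {a} {b} _ (a≤1+b+s , b≤a+s) a≤q+s 1+b≤q+s with Natₚ.≤-total a b
  ... | inj₁ a≤b with a Natₚ.<? suc q′
  ...   | yes a<q = a , a<q , (Natₚ.≤-refl , Natₚ.m≤n⇒m≤1+n (Natₚ.m≤m+n a s)) , (a≤b , b≤a+s)
  ...   | no  a≮q =
    q′ , Natₚ.≤-refl , (q′≤a , a≤q+s) , (Natₚ.≤-trans q′≤a a≤b , Natₚ.≤-pred 1+b≤q+s)
    where q′≤a = Natₚ.<⇒≤ (Natₚ.≮⇒≥ a≮q)
  band⇒windows (suc q′) {a} {b} _ (a≤1+b+s , b≤a+s) a≤q+s 1+b≤q+s | inj₂ b≤a with b Natₚ.<? suc q′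
  ...   | yes b<q = b , b<q , (b≤a , a≤1+b+s) , (Natₚ.≤-refl , Natₚ.m≤m+n b s)
  ...   | no  b≮q =
    q′ , Natₚ.≤-refl , (Natₚ.≤-trans q′≤b b≤a , a≤q+s) , (q′≤b , Natₚ.≤-pred 1+b≤q+s)
    where q′≤b = Natₚ.<⇒≤ (Natₚ.≮⇒≥ b≮q)

splitAt-injective : ∀ m {n} {u u′ : Fin (m + n)} → Fin.splitAt m u ≡ Fin.splitAt m u′ → u ≡ u′
splitAt-injective m {n} {u} {u′} eq =
  trans (sym (Finₚ.join-splitAt m n u)) (trans (cong (Fin.join m n) eq) (Finₚ.join-splitAt m n u′))

module LowerBound (ℝ : RealField) (n s : ℕ) where
  open RealField ℝ using (0#)
  open LinearAlgebra ℝ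
    using (IndependentColumns; triangular⇒independent; nonadjacent⇒entry≡0; adjacent⇒entry≢0;
           entry≢0⇒independent-pair)

  private
    P : Graph n
    P = pathGraph n
    r : ℕ
    r = suc (s + s)
    r-odd : parity r ≡ 1ℙ
    r-odd = parity-suc-double s

  module _ {A : Matrix ℝ n} (A∈S : InSkew ℝ (strictPower P r) A) where

    walk⇒entry≢0 : ∀ {i j} → Walk P r i j → A i j ≢ 0#
    walk⇒entry≢0 w = adjacent⇒entry≢0 A∈S i≢j (i≢j , w)
      where i≢j = odd-walk⇒distinct r-odd w

    ¬walk⇒entry≡0 : ∀ {i j} → ¬ Walk P r i j → A i j ≡ 0#
    ¬walk⇒entry≡0 ¬w = nonadjacent⇒entry≡0 A∈S (¬w ∘ proj₂)

    two-independent-columns : 2 ≤ n → IndependentColumns A 2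
    two-independent-columns 2≤n = entry≢0⇒independent-pair A∈S {i = v₀} {j = v₁} (walk⇒entry≢0 w)
      where
      v₀ v₁ : Fin n
      v₀ = fromℕ< (Natₚ.<-trans (s≤s z≤n) 2≤n)
      v₁ = fromℕ< 2≤n
      w : Walk P r v₀ v₁
      w = ascendingWalk 1 (trans (cong (_+ 1) (Finₚ.toℕ-fromℕ< _)) (sym (Finₚ.toℕ-fromℕ< 2≤n)))
          ++ʷ backAndForth 2≤n s v₁

    module _ (q : ℕ) (2q+r≤1+n : q + q + r ≤ suc n) where

      private
        odd-bound : (t : Fin q) → toℕ t + toℕ t + r < n
        odd-bound t = Natₚ.≤-pred (begin
          suc (suc (toℕ t + toℕ t)) + r  ≡⟨ cong (λ x → suc x + r) (Natₚ.+-suc (toℕ t) (toℕ t)) ⟨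
          suc (toℕ t) + suc (toℕ t) + r  ≤⟨ Natₚ.+-monoˡ-≤ r (Natₚ.+-mono-≤ t<q t<q) ⟩
          q + q + r                      ≤⟨ 2q+r≤1+n ⟩
          suc n                          ∎)
          where
          open Natₚ.≤-Reasoning
          t<q = Finₚ.toℕ<n t

        even odd : Fin q → Fin n
        even t = fromℕ< (Natₚ.≤-<-trans (Natₚ.m≤m+n _ r) (odd-bound t))
        odd  t = fromℕ< (odd-bound t)

        toℕ-even : ∀ t → toℕ (even t) ≡ toℕ t + toℕ t
        toℕ-even t = Finₚ.toℕ-fromℕ< _

        toℕ-odd : ∀ t → toℕ (odd t) ≡ toℕ t + toℕ t + r
        toℕ-odd t = Finₚ.toℕ-fromℕ< _

        parity-even : ∀ t → parity (toℕ (even t)) ≡ 0ℙ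
        parity-even t = trans (cong parity (toℕ-even t)) (parity-double (toℕ t))

        parity-odd : ∀ t → parity (toℕ (odd t)) ≡ 1ℙ
        parity-odd t = begin
          parity (toℕ (odd t))                  ≡⟨ cong parity (toℕ-odd t) ⟩
          parity (toℕ t + toℕ t + r)            ≡⟨ ℙₚ.+-homo-+ (toℕ t + toℕ t) r ⟩
          parity (toℕ t + toℕ t) ℙ.+ parity r   ≡⟨ cong₂ ℙ._+_ (parity-double (toℕ t)) r-odd ⟩
          1ℙ                                    ∎
          where open ≡-Reasoning

        even⇝odd : ∀ t → Walk P r (even t) (odd t)
        even⇝odd t = ascendingWalk r (trans (cong (_+ r) (toℕ-even t)) (sym (toℕ-odd t)))

        even+r<odd : ∀ {t t′} → toℕ t′ < toℕ t → toℕ (even t′) + r < toℕ (odd t)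
        even+r<odd {t} {t′} t′<t = subst₂ (λ x y → x + r < y) (sym (toℕ-even t′)) (sym (toℕ-odd t))
                                          (Natₚ.+-monoˡ-< r (Natₚ.+-mono-< t′<t t′<t))

        column row : Fin q ⊎ Fin q → Fin n
        column (inj₁ t) = even t
        column (inj₂ t) = odd t
        row (inj₁ t) = odd t
        row (inj₂ t) = even t

        rank : Fin q ⊎ Fin q → ℕ
        rank (inj₁ t) = q ∸ toℕ t
        rank (inj₂ t) = toℕ t

        pivot≢0 : ∀ x → A (row x) (column x) ≢ 0#
        pivot≢0 (inj₁ t) = walk⇒entry≢0 (reverseWalk (even⇝odd t))
        pivot≢0 (inj₂ t) = walk⇒entry≢0 (even⇝odd t)

        off-pivot : ∀ x x′ → x′ ≢ x → A (row x) (column x′) ≡ 0# ⊎ rank x′ < rank x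
        off-pivot (inj₁ t) (inj₁ t′) x′≢x with Natₚ.<-cmp (toℕ t′) (toℕ t)
        ... | tri< t′<t _ _ =
          inj₁ (¬walk⇒entry≡0 (λ w → Natₚ.<⇒≱ (even+r<odd t′<t) (walk⇒≤ (reverseWalk w))))
        ... | tri≈ _ t′≡t _ = ⊥-elim (x′≢x (cong inj₁ (Finₚ.toℕ-injective t′≡t)))
        ... | tri> _ _ t<t′ = inj₂ (Natₚ.∸-monoʳ-< t<t′ (Natₚ.<⇒≤ (Finₚ.toℕ<n t′)))
        off-pivot (inj₂ t) (inj₂ t′) x′≢x with Natₚ.<-cmp (toℕ t′) (toℕ t)
        ... | tri< t′<t _ _ = inj₂ t′<t
        ... | tri≈ _ t′≡t _ = ⊥-elim (x′≢x (cong inj₂ (Finₚ.toℕ-injective t′≡t)))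
        ... | tri> _ _ t<t′ = inj₁ (¬walk⇒entry≡0 (λ w → Natₚ.<⇒≱ (even+r<odd t<t′) (walk⇒≤ w)))
        off-pivot (inj₁ t) (inj₂ t′) _ =
          inj₁ (¬walk⇒entry≡0 (same-parity⇒¬odd-walk r-odd (trans (parity-odd t) (sym (parity-odd t′)))))
        off-pivot (inj₂ t) (inj₁ t′) _ =
          inj₁ (¬walk⇒entry≡0 (same-parity⇒¬odd-walk r-odd (trans (parity-even t) (sym (parity-even t′)))))

      independent-columns : IndependentColumns A (q + q)
      independent-columns = column ∘ Fin.splitAt q ,
        triangular⇒independent A (column ∘ Fin.splitAt q) (row ∘ Fin.splitAt q) (rank ∘ Fin.splitAt q)
          (pivot≢0 ∘ Fin.splitAt q)
          (λ u u′ u′≢u → off-pivot (Fin.splitAt q u) (Fin.splitAt q u′) (u′≢u ∘ splitAt-injective q))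

module UpperBound (ℝ : RealField) (n s q : ℕ) (2≤n : 2 ≤ n) (1≤q : 1 ≤ q)
                  (n≤2q+r : n ≤ q + q + suc (s + s)) where
  open RealField ℝ using (R; 0#; 1#; _*_; -_; _≤ᵣ_; ≤-refl; *-nonneg)
  open LinearAlgebra ℝ
  open CommutativeRing commutativeRing using (zeroˡ; zeroʳ; *-comm; ring) renaming (_+_ to _+ᵣ_)
  open import Algebra.Properties.Ring ring using (-0#≈0#; -‿distribʳ-*)
  open Windows s

  private
    P : Graph n
    P = pathGraph n
    r : ℕ
    r = suc (s + s)
    r-odd : parity r ≡ 1ℙ
    r-odd = parity-suc-double s

  walk⇔band : ∀ {i j a b} → toℕ i ≡ a + a → toℕ j ≡ suc (b + b) → Walk P r i j ⇔ Band a b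
  walk⇔band {i} {j} {a} {b} i≡2a j≡2b+1 = mk⇔ to from
    where
    to : Walk P r i j → Band a b
    to w = x+x≤1+y+y⇒x≤y a (suc (b + s)) (Natₚ.m≤n⇒m≤1+n (begin
             a + a                          ≡⟨ i≡2a ⟨
             toℕ i                          ≤⟨ walk⇒≤ (reverseWalk w) ⟩
             toℕ j + r                      ≡⟨ cong (_+ r) j≡2b+1 ⟩
             suc (b + b) + r                ≡⟨ [1+x+x]+[1+s+s]≡[1+x+s]+[1+x+s] b s ⟩
             suc (b + s) + suc (b + s)      ∎)) ,
           x+x≤1+y+y⇒x≤y b (a + s) (Natₚ.m≤n⇒m≤1+n (Natₚ.≤-pred (begin
             suc (b + b)                    ≡⟨ j≡2b+1 ⟨
             toℕ j                          ≤⟨ walk⇒≤ w ⟩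
             toℕ i + r                      ≡⟨ cong (_+ r) i≡2a ⟩
             a + a + r                      ≡⟨ x+x+[1+s+s]≡1+[x+s]+[x+s] a s ⟩
             suc ((a + s) + (a + s))        ∎)))
      where open Natₚ.≤-Reasoning

    parity-i+j : parity (toℕ i + toℕ j) ≡ parity r
    parity-i+j = begin
      parity (toℕ i + toℕ j)                   ≡⟨ cong₂ (λ x y → parity (x + y)) i≡2a j≡2b+1 ⟩
      parity (a + a + suc (b + b))             ≡⟨ ℙₚ.+-homo-+ (a + a) (suc (b + b)) ⟩
      parity (a + a) ℙ.+ parity (suc (b + b))  ≡⟨ cong₂ ℙ._+_ (parity-double a) (parity-suc-double b) ⟩
      1ℙ                                       ≡⟨ r-odd ⟨
      parity r                                 ∎
      where open ≡-Reasoning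

    from : Band a b → Walk P r i j
    from (a≤1+b+s , b≤a+s) = walk-exists 2≤n
      (begin
        toℕ j                    ≡⟨ j≡2b+1 ⟩
        suc (b + b)              ≤⟨ s≤s (Natₚ.+-mono-≤ b≤a+s b≤a+s) ⟩
        suc ((a + s) + (a + s))  ≡⟨ x+x+[1+s+s]≡1+[x+s]+[x+s] a s ⟨
        a + a + r                ≡⟨ cong (_+ r) i≡2a ⟨
        toℕ i + r                ∎)
      (begin
        toℕ i                      ≡⟨ i≡2a ⟩
        a + a                      ≤⟨ Natₚ.+-mono-≤ a≤1+b+s a≤1+b+s ⟩
        suc (b + s) + suc (b + s)  ≡⟨ [1+x+x]+[1+s+s]≡[1+x+s]+[1+x+s] b s ⟨
        suc (b + b) + r            ≡⟨ cong (_+ r) j≡2b+1 ⟨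
        toℕ j + r                  ∎)
      parity-i+j
      where open Natₚ.≤-Reasoning

  atEven atOdd : (ℕ → R) → ℕ → R
  atEven f x with parity x
  ... | 0ℙ = f ⌊ x /2⌋
  ... | 1ℙ = 0#
  atOdd f x with parity x
  ... | 0ℙ = 0#
  ... | 1ℙ = f ⌊ x /2⌋

  atEven-double : ∀ f a → atEven f (a + a) ≡ f a
  atEven-double f a rewrite parity-double a = cong f (⌊double/2⌋ a)

  atEven-suc-double : ∀ f a → atEven f (suc (a + a)) ≡ 0#
  atEven-suc-double f a rewrite parity-suc-double a = refl

  atOdd-double : ∀ f a → atOdd f (a + a) ≡ 0#
  atOdd-double f a rewrite parity-double a = refl

  atOdd-suc-double : ∀ f a → atOdd f (suc (a + a)) ≡ f a
  atOdd-suc-double f a rewrite parity-suc-double a = cong f (⌊suc-double/2⌋ a)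

  atEven-nonneg : ∀ {f} → (∀ a → 0# ≤ᵣ f a) → ∀ x → 0# ≤ᵣ atEven f x
  atEven-nonneg 0≤f x with parity x
  ... | 0ℙ = 0≤f ⌊ x /2⌋
  ... | 1ℙ = ≤-refl 0#

  atOdd-nonneg : ∀ {f} → (∀ a → 0# ≤ᵣ f a) → ∀ x → 0# ≤ᵣ atOdd f x
  atOdd-nonneg 0≤f x with parity x
  ... | 0ℙ = ≤-refl 0#
  ... | 1ℙ = 0≤f ⌊ x /2⌋

  u v : Fin q → Fin n → R
  u k i = atEven (indicator ∘ evenWindow? (toℕ k)) (toℕ i)
  v k j = atOdd (indicator ∘ oddWindow? (toℕ k)) (toℕ j)

  B : Matrix ℝ n
  B i j = sum (λ k → u k i * v k j)

  A₀ : Matrix ℝ n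
  A₀ i j = B i j - B j i

  u-nonneg : ∀ k i → 0# ≤ᵣ u k i
  u-nonneg k i = atEven-nonneg (indicator-nonneg ∘ evenWindow? (toℕ k)) (toℕ i)

  v-nonneg : ∀ k j → 0# ≤ᵣ v k j
  v-nonneg k j = atOdd-nonneg (indicator-nonneg ∘ oddWindow? (toℕ k)) (toℕ j)

  B-odd-row : ∀ {i a} j → toℕ i ≡ suc (a + a) → B i j ≡ 0#
  B-odd-row {i} {a} j i≡2a+1 = sum-zero (λ k →
    trans (cong (_* v k j) (trans (cong (atEven _) i≡2a+1) (atEven-suc-double _ a))) (zeroˡ (v k j)))

  B-even-column : ∀ i {j b} → toℕ j ≡ b + b → B i j ≡ 0#
  B-even-column i {j} {b} j≡2b = sum-zero (λ k →
    trans (cong (u k i *_) (trans (cong (atOdd _) j≡2b) (atOdd-double _ b))) (zeroʳ (u k i)))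

  even-index-bound : ∀ {i : Fin n} {a} → toℕ i ≡ a + a → a ≤ q + s
  even-index-bound {i} {a} i≡2a = x+x≤1+y+y⇒x≤y a (q + s) (Natₚ.<⇒≤ (begin-strict
    a + a                    ≡⟨ i≡2a ⟨
    toℕ i                    <⟨ Finₚ.toℕ<n i ⟩
    n                        ≤⟨ n≤2q+r ⟩
    q + q + r                ≡⟨ x+x+[1+s+s]≡1+[x+s]+[x+s] q s ⟩
    suc ((q + s) + (q + s))  ∎))
    where open Natₚ.≤-Reasoning

  odd-index-bound : ∀ {j : Fin n} {b} → toℕ j ≡ suc (b + b) → suc b ≤ q + s
  odd-index-bound {j} {b} j≡2b+1 = x+x≤1+y+y⇒x≤y (suc b) (q + s) (begin
    suc b + suc b            ≡⟨ cong suc (Natₚ.+-suc b b) ⟩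
    suc (suc (b + b))        ≡⟨ cong suc j≡2b+1 ⟨
    suc (toℕ j)              ≤⟨ Finₚ.toℕ<n j ⟩
    n                        ≤⟨ n≤2q+r ⟩
    q + q + r                ≡⟨ x+x+[1+s+s]≡1+[x+s]+[x+s] q s ⟩
    suc ((q + s) + (q + s))  ∎)
    where open Natₚ.≤-Reasoning

  B≢0⇔band : ∀ {i j a b} → toℕ i ≡ a + a → toℕ j ≡ suc (b + b) → (B i j ≢ 0#) ⇔ Band a b
  B≢0⇔band {i} {j} {a} {b} i≡2a j≡2b+1 = mk⇔ to from
    where
    u-value : ∀ k → u k i ≡ indicator (evenWindow? (toℕ k) a)
    u-value k = trans (cong (atEven _) i≡2a) (atEven-double _ a)
    v-value : ∀ k → v k j ≡ indicator (oddWindow? (toℕ k) b)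
    v-value k = trans (cong (atOdd _) j≡2b+1) (atOdd-suc-double _ b)

    to : B i j ≢ 0# → Band a b
    to B≢0 with k , term≢0 ← sum≢0⇒∃≢0 (λ k → u k i * v k j) B≢0 = windows⇒band
      (indicator≢0⇒holds (evenWindow? (toℕ k) a)
        (λ z → term≢0 (trans (cong (_* v k j) (trans (u-value k) z)) (zeroˡ (v k j)))))
      (indicator≢0⇒holds (oddWindow? (toℕ k) b)
        (λ z → term≢0 (trans (cong (u k i *_) (trans (v-value k) z)) (zeroʳ (u k i)))))

    from : Band a b → B i j ≢ 0#
    from band with k , k<q , even-window , odd-window ←
                   band⇒windows q 1≤q band (even-index-bound i≡2a) (odd-index-bound j≡2b+1) =
      nonneg-sum≢0 (λ k → u k i * v k j) (λ k → *-nonneg (u-nonneg k i) (v-nonneg k j)) kᶠ term≢0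
      where
      kᶠ = fromℕ< k<q
      toℕ-kᶠ = Finₚ.toℕ-fromℕ< k<q
      term≢0 : u kᶠ i * v kᶠ j ≢ 0#
      term≢0 = *-nonzero
        (subst (_≢ 0#) (sym (trans (u-value kᶠ) (indicator-holds (evenWindow? _ a)
                 (subst (λ k → EvenWindow k a) (sym toℕ-kᶠ) even-window)))) 1≢0)
        (subst (_≢ 0#) (sym (trans (v-value kᶠ) (indicator-holds (oddWindow? _ b)
                 (subst (λ k → OddWindow k b) (sym toℕ-kᶠ) odd-window)))) 1≢0)

  private
    ≢0-cong : ∀ {x y} → x ≡ y → (x ≢ 0#) ⇔ (y ≢ 0#)
    ≢0-cong refl = mk⇔ id id

    -‿≢0⇔ : ∀ {x} → (- x ≢ 0#) ⇔ (x ≢ 0#)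
    -‿≢0⇔ = mk⇔ (λ -x≢0 x≡0 → -x≢0 (trans (cong -_ x≡0) -0#≈0#)) -‿nonzero

    reverse⇔ : ∀ {i j} → Walk P r i j ⇔ Walk P r j i
    reverse⇔ = mk⇔ reverseWalk reverseWalk

    vanishing⇔ : ∀ {i j} → A₀ i j ≡ 0# → ¬ Walk P r i j → (A₀ i j ≢ 0#) ⇔ Walk P r i j
    vanishing⇔ A₀ij≡0 ¬walk = mk⇔ (λ A₀ij≢0 → ⊥-elim (A₀ij≢0 A₀ij≡0)) (⊥-elim ∘ ¬walk)

  even-odd-B≢0⇔walk : ∀ {i j a b} → toℕ i ≡ a + a → toℕ j ≡ suc (b + b) → (B i j ≢ 0#) ⇔ Walk P r i j
  even-odd-B≢0⇔walk {a = a} {b} i≡2a j≡2b+1 =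
    ⇔-trans (B≢0⇔band {a = a} {b} i≡2a j≡2b+1) (⇔-sym (walk⇔band {a = a} {b} i≡2a j≡2b+1))

  entry≢0⇔walk : ∀ i j → (A₀ i j ≢ 0#) ⇔ Walk P r i j
  entry≢0⇔walk i j with even-or-odd (toℕ i) | even-or-odd (toℕ j)
  ... | inj₁ (a , i≡2a) | inj₁ (b , j≡2b) =
    vanishing⇔ (trans (cong₂ _-_ (B-even-column i {b = b} j≡2b) (B-even-column j {b = a} i≡2a))
                      (x-0≡x 0#))
               (same-parity⇒¬odd-walk r-odd (trans (double⇒even {a = a} i≡2a) (sym (double⇒even {a = b} j≡2b))))
  ... | inj₂ (a , i≡2a+1) | inj₂ (b , j≡2b+1) =
    vanishing⇔ (trans (cong₂ _-_ (B-odd-row {a = a} j i≡2a+1) (B-odd-row {a = b} i j≡2b+1))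
                      (x-0≡x 0#))
               (same-parity⇒¬odd-walk r-odd (trans (suc-double⇒odd {a = a} i≡2a+1) (sym (suc-double⇒odd {a = b} j≡2b+1))))
  ... | inj₁ (a , i≡2a) | inj₂ (b , j≡2b+1) =
    ⇔-trans (≢0-cong (trans (cong (λ x → B i j - x) (B-odd-row {a = b} i j≡2b+1)) (x-0≡x (B i j))))
            (even-odd-B≢0⇔walk {a = a} {b} i≡2a j≡2b+1)
  ... | inj₂ (a , i≡2a+1) | inj₁ (b , j≡2b) =
    ⇔-trans (≢0-cong (trans (cong (_- B j i) (B-odd-row {a = a} j i≡2a+1)) (0-x≡-x (B j i))))
      (⇔-trans -‿≢0⇔ (⇔-trans (even-odd-B≢0⇔walk {a = b} {a} j≡2b i≡2a+1) reverse⇔))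

  A₀∈S : InSkew ℝ (strictPower P r) A₀
  A₀∈S = (λ i j → x-y≡-[y-x] (B i j) (B j i)) ,
         λ i j i≢j → (λ A₀ij≢0 → i≢j , Equivalence.to (entry≢0⇔walk i j) A₀ij≢0) ,
                     (Equivalence.from (entry≢0⇔walk i j) ∘ proj₂)

  X : Fin n → Fin (q + q) → R
  X i = (λ k → u k i) ++ (λ k → v k i)

  Y : Fin (q + q) → Fin n → R
  Y l j = ((λ k → v k j) ++ (λ k → - u k j)) l

  A₀≡XY : ∀ i j → A₀ i j ≡ sum (λ l → X i l * Y l j)
  A₀≡XY i j = sym (begin
    sum (λ l → X i l * Y l j)
      ≡⟨ sum-↑ q (λ l → X i l * Y l j) ⟩
    sum (λ k → X i (k ↑ˡ q) * Y (k ↑ˡ q) j) +ᵣ sum (λ k → X i (q ↑ʳ k) * Y (q ↑ʳ k) j)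
      ≡⟨ cong₂ _+ᵣ_ (sum-cong-≗ left) (sum-cong-≗ right) ⟩
    B i j +ᵣ sum (λ k → - (u k j * v k i))
      ≡⟨ cong (B i j +ᵣ_) (sum-neg (λ k → u k j * v k i)) ⟩
    B i j - B j i ∎)
    where
    open ≡-Reasoning
    left : ∀ k → X i (k ↑ˡ q) * Y (k ↑ˡ q) j ≡ u k i * v k j
    left k = cong₂ _*_ (lookup-++ˡ (λ k → u k i) _ k) (lookup-++ˡ (λ k → v k j) _ k)
    right : ∀ k → X i (q ↑ʳ k) * Y (q ↑ʳ k) j ≡ - (u k j * v k i)
    right k = begin
      X i (q ↑ʳ k) * Y (q ↑ʳ k) j
        ≡⟨ cong₂ _*_ (lookup-++ʳ (λ k → u k i) _ k) (lookup-++ʳ (λ k → v k j) _ k) ⟩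
      v k i * - u k j              ≡⟨ -‿distribʳ-* (v k i) (u k j) ⟨
      - (v k i * u k j)            ≡⟨ cong -_ (*-comm (v k i) (u k j)) ⟩
      - (u k j * v k i)            ∎

module _ (ℝ : RealField) where
  open LinearAlgebra ℝ using (IndependentColumns; factorization⇒isMinSkewRank)

  isMinSkewRank-2q : ∀ n s q → 2 ≤ n → 1 ≤ q → n ≤ q + q + suc (s + s) →
    (∀ A → InSkew ℝ (strictPower (pathGraph n) (suc (s + s))) A → IndependentColumns A (q + q)) →
    IsMinSkewRank ℝ (strictPower (pathGraph n) (suc (s + s))) (q + q)
  isMinSkewRank-2q n s q 2≤n 1≤q n≤2q+r lower =
    factorization⇒isMinSkewRank _ (q + q) lower A₀ A₀∈S X Y A₀≡XY
    where open UpperBound ℝ n s q 2≤n 1≤q n≤2q+r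

  isMinSkewRank-even : ∀ n s m → 2 ≤ n → parity m ≡ 0ℙ → 0 < m →
    n ≤ m + suc (s + s) → m + suc (s + s) ≤ suc n →
    IsMinSkewRank ℝ (strictPower (pathGraph n) (suc (s + s))) m
  isMinSkewRank-even n s m 2≤n m-even 0<m n≤m+r m+r≤1+n with even⇒double m m-even
  ... | zero   , refl = ⊥-elim (Natₚ.n≮0 0<m)
  ... | suc q′ , refl = isMinSkewRank-2q n s (suc q′) 2≤n (s≤s z≤n) n≤m+r
    (λ A A∈S → LowerBound.independent-columns ℝ n s A∈S (suc q′) m+r≤1+n)

  isMinSkewRank-n∸r : ∀ n s → 3 ≤ n → suc (s + s) ≤ n ∸ 3 → parity n ≡ 1ℙ →
    IsMinSkewRank ℝ (strictPower (pathGraph n) (suc (s + s))) (n ∸ suc (s + s))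
  isMinSkewRank-n∸r n s 3≤n r≤n∸3 n-odd = isMinSkewRank-even n s (n ∸ r) (Natₚ.<⇒≤ 3≤n)
    (odd∸odd≡even r≤n n-odd (parity-suc-double s))
    (Natₚ.m<n⇒0<n∸m r<n)
    (Natₚ.≤-reflexive (sym (Natₚ.m∸n+n≡m r≤n)))
    (Natₚ.≤-trans (Natₚ.≤-reflexive (Natₚ.m∸n+n≡m r≤n)) (Natₚ.n≤1+n n))
    where
    r = suc (s + s)
    r<n = m≤o∸n⇒m<o (s≤s z≤n) 3≤n r≤n∸3
    r≤n = Natₚ.<⇒≤ r<n

  isMinSkewRank-n∸r+1 : ∀ n s → 3 ≤ n → suc (s + s) ≤ n ∸ 3 → parity n ≡ 0ℙ →
    IsMinSkewRank ℝ (strictPower (pathGraph n) (suc (s + s))) (n ∸ suc (s + s) + 1)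
  isMinSkewRank-n∸r+1 n s 3≤n r≤n∸3 n-even = isMinSkewRank-even n s (n ∸ r + 1) (Natₚ.<⇒≤ 3≤n)
    (even∸odd+1≡even r≤n n-even (parity-suc-double s))
    (subst (0 <_) (Natₚ.+-comm 1 (n ∸ r)) (s≤s z≤n))
    (Natₚ.≤-trans (Natₚ.n≤1+n n) (Natₚ.≤-reflexive (sym (m∸n+1+n≡1+m r≤n))))
    (Natₚ.≤-reflexive (m∸n+1+n≡1+m r≤n))
    where
    r = suc (s + s)
    r≤n = Natₚ.<⇒≤ (m≤o∸n⇒m<o (s≤s z≤n) 3≤n r≤n∸3)

  isMinSkewRank-2 : ∀ n s → 3 ≤ n → n ∸ 2 ≤ suc (s + s) → IsMinSkewRank ℝ (strictPower (pathGraph n) (suc (s + s))) 2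
  isMinSkewRank-2 n s 3≤n n∸2≤r = isMinSkewRank-2q n s 1 (Natₚ.<⇒≤ 3≤n) (s≤s z≤n)
    (Natₚ.≤-trans (Natₚ.m≤n+m∸n n 2) (Natₚ.+-monoʳ-≤ 2 n∸2≤r))
    (λ A A∈S → LowerBound.two-independent-columns ℝ n s A∈S (Natₚ.<⇒≤ 3≤n))

mainTheorem3 : (ℝ : RealField) (n r : ℕ) → 3 ≤ n → 1 ≤ r → r % 2 ≡ 1 →
    ((r ≤ n ∸ 3 → n % 2 ≡ 1 → IsMinSkewRank ℝ (strictPower (pathGraph n) r) (n ∸ r)) ×
     (r ≤ n ∸ 3 → n % 2 ≡ 0 → IsMinSkewRank ℝ (strictPower (pathGraph n) r) (n ∸ r + 1)) ×
     (n ∸ 2 ≤ r → IsMinSkewRank ℝ (strictPower (pathGraph n) r) 2))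
-- The hypothesis 1 ≤ r is implied by r being odd.
mainTheorem3 ℝ n r 3≤n _ r%2≡1 with s , refl ← odd⇒suc-double r (%2≡1⇒odd r r%2≡1) =
  (λ r≤n∸3 n%2≡1 → isMinSkewRank-n∸r ℝ n s 3≤n r≤n∸3 (%2≡1⇒odd n n%2≡1)) ,
  (λ r≤n∸3 n%2≡0 → isMinSkewRank-n∸r+1 ℝ n s 3≤n r≤n∸3 (%2≡0⇒even n n%2≡0)) ,
  isMinSkewRank-2 ℝ n s 3≤n
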